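{- For all integers $r\geq 2$, $\mathcal{B}_{r,r}=\mathcal{D}_{r,r}$.
   Context: A partition is a non-increasing finite sequence of positive integers (possibly empty). For a partition $\mu=(\mu_1,\dots,\mu_t)$ let $\mathrm{sq}(\mu)=\max\{d\ge0: d\le t,\ \mu_d\ge d\}$ (side of the Durfee square). $\mathcal{D}_{r,r}$ is the set of partitions $\lambda$ such that, setting $\mu^{(0)}=\lambda$ and letting $\mu^{(j)}$ be $\mu^{(j-1)}$ with its first $\mathrm{sq}(\mu^{(j-1)})$ parts deleted, $\mu^{(r-1)}$ is empty (i.e. $\lambda$ has at most $r-1$ successive non-empty Durfee squares). $\mathcal{B}_{r,r}$ is the set of partitions $\lambda$ such that, setting $\nu^{(0)}=\lambda$ and letting $\nu^{(j)}$ be obtained from $\nu^{(j-1)}=(\nu_1,\dots,\nu_t)$ by deleting its last $\min(\nu_t,t)$ parts (removal of the bottom square of side $\nu_t$; nothing is done if $\nu^{(j-1)}$ is empty), $\nu^{(r-1)}$ is empty. -}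

module Defs where

open import Data.Nat using (ℕ; zero; suc; _≤_; _<_; _≤?_; _⊔_; _⊓_; _∸_)
open import Data.List using (List; []; _∷_; length; drop; reverse; last)
open import Data.List.Relation.Unary.All using (All)
open import Data.List.Relation.Unary.Linked using (Linked)
open import Data.Maybe using (Maybe; just; nothing)
open import Relation.Nullary.Decidable using (does)
open import Data.Bool using (if_then_else_)

IsPartition : List ℕ → Set
IsPartition μ = All (λ x → 1 ≤ x) μ × Linked (λ a b → b ≤ a) μ
  where open import Data.Product using (_×_)

-- Side of the Durfee square, literally:
--   sq(μ) = max { d ≥ 0 : d ≤ t, μ_d ≥ d }   (1-indexed parts, d = 0 always allowed)
-- sqFrom d μ scans the parts μ_d, μ_{d+1}, … (μ being the suffix starting at index d)
-- and returns the largest index e ≥ d with μ_e ≥ e, or 0 if none.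
sqFrom : ℕ → List ℕ → ℕ
sqFrom d [] = 0
sqFrom d (x ∷ xs) = (if does (d ≤? x) then d else 0) ⊔ sqFrom (suc d) xs

sq : List ℕ → ℕ
sq μ = sqFrom 1 μ

removeDurfee : List ℕ → List ℕ
removeDurfee μ = drop (sq μ) μ

removeBottom : List ℕ → List ℕ
removeBottom ν with last ν
... | nothing = []
... | just νt = reverse (drop (νt ⊓ length ν) (reverse ν))

iter : {A : Set} → (A → A) → ℕ → A → A
iter f zero a = a
iter f (suc n) a = f (iter f n a)

InD : ℕ → List ℕ → Set
InD r λ' = IsPartition λ' × iter removeDurfee (r ∸ 1) λ' ≡ []
  where open import Data.Product using (_×_)
        open import Relation.Binary.PropositionalEquality using (_≡_)

InB : ℕ → List ℕ → Set
InB r λ' = IsPartition λ' × iter removeBottom (r ∸ 1) λ' ≡ []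
  where open import Data.Product using (_×_)
        open import Relation.Binary.PropositionalEquality using (_≡_)

-- Both classes coincide with the partitions that can be cut into at most r − 1
-- consecutive blocks of rows, where a block of t rows has all its parts ≥ t
-- (it contains a t × t square). Removing the top Durfee square, or the bottom
-- square of side νₜ, is greedy for such cuttings: the removed rows cover the first
-- (resp. last) block, so what remains is cut into one block fewer. Conversely, on a
-- partition the removed rows form a block themselves, so r − 1 removals that empty
-- λ exhibit a cutting into r − 1 blocks.
module Submission where

open import Defs
open import Data.Nat using (ℕ; _≤_)
open import Data.List using (List)
open import Data.Product using (_×_)

open import Data.Nat using (zero; suc; _+_; _⊓_; _∸_; _≤?_; z≤n; s≤s)
open import Data.Nat.Properties
open import Data.List using ([]; _∷_; _++_; _ʳ++_; length; take; drop; reverse; last)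
open import Data.List.Properties
  using (++-identityʳ; ++-assoc; length-++; length-take; take++drop≡id; drop-[]; drop-drop; reverse-++;
         reverse-involutive; reverse-injective; length-reverse)
open import Data.List.Relation.Unary.All as All using (All; []; _∷_)
open import Data.List.Relation.Unary.All.Properties using (take⁺)
open import Data.List.Relation.Binary.Permutation.Propositional using (↭-sym)
open import Data.List.Relation.Binary.Permutation.Propositional.Properties
  using (All-resp-↭; ↭-reverse)
open import Data.List.Relation.Unary.Linked as Linked using (Linked; []; [-]; _∷_)
open import Data.List.Relation.Unary.Linked.Properties using (Linked⇒All)
open import Data.Maybe using (just)
open import Data.Product using (_,_; ∃)
open import Data.Sum using (_⊎_; inj₁; inj₂)
open import Data.Bool using (if_then_else_)
open import Function using (flip)
open import Function.Bundles using (_⇔_; mk⇔; module Equivalence)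
import Function.Properties.Equivalence as ⇔
open import Function.Related.Propositional using (module EquationalReasoning; equivalence)
open import Relation.Binary.Core using (Rel)
open import Relation.Binary.PropositionalEquality
open import Relation.Nullary.Decidable using (Dec; does; yes; no; dec-true)

Sorted : List ℕ → Set
Sorted = Linked (flip _≤_)

iter-suc : ∀ {A : Set} (f : A → A) k a → iter f (suc k) a ≡ iter f k (f a)
iter-suc f zero    a = refl
iter-suc f (suc k) a = cong f (iter-suc f k a)

Linked-drop : ∀ {ℓ} {R : Rel ℕ ℓ} n {xs} → Linked R xs → Linked R (drop n xs)
Linked-drop zero    l = l
Linked-drop (suc n) {[]}    l = []
Linked-drop (suc n) {_ ∷ _} l = Linked-drop n (Linked.tail l)

Linked-reverse : ∀ {ℓ} {R : Rel ℕ ℓ} {xs} → Linked R xs → Linked (flip R) (reverse xs)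
Linked-reverse []            = []
Linked-reverse {xs = _ ∷ _} l = onto l [-]
  where
  onto : ∀ {ℓ} {R : Rel ℕ ℓ} {x xs acc} →
         Linked R (x ∷ xs) → Linked (flip R) (x ∷ acc) → Linked (flip R) (xs ʳ++ x ∷ acc)
  onto [-]     l′ = l′
  onto (r ∷ l) l′ = onto l (r ∷ l′)

All-reverse : ∀ {P : ℕ → Set} {xs} → All P xs → All P (reverse xs)
All-reverse {xs = xs} = All-resp-↭ (↭-sym (↭-reverse xs))

SquareBlock : List ℕ → Set
SquareBlock a = All (length a ≤_) a

data SquareBlocks : ℕ → List ℕ → Set where
  []    : ∀ {k} → SquareBlocks k []
  block : ∀ {k} a {b} → SquareBlock a → SquareBlocks k b → SquareBlocks (suc k) (a ++ b)

SquareBlock-tail : ∀ {x a} → SquareBlock (x ∷ a) → SquareBlock a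
SquareBlock-tail (_ ∷ ps) = All.map (≤-trans (n≤1+n _)) ps

SquareBlock-take : ∀ m xs → All (m ≤_) (take m xs) → SquareBlock (take m xs)
SquareBlock-take m xs = All.map (≤-trans (≤-trans (≤-reflexive (length-take m xs)) (m⊓n≤m m _)))

SquareBlock-reverse : ∀ {a} → SquareBlock a → SquareBlock (reverse a)
SquareBlock-reverse {a} v = subst (λ n → All (n ≤_) (reverse a)) (sym (length-reverse a)) (All-reverse v)

SquareBlocks-zero : ∀ {xs} → SquareBlocks 0 xs → xs ≡ []
SquareBlocks-zero [] = refl

SquareBlocks-suc : ∀ {k xs} → SquareBlocks k xs → SquareBlocks (suc k) xs
SquareBlocks-suc []            = []
SquareBlocks-suc (block a v c) = block a v (SquareBlocks-suc c)

SquareBlocks-tail : ∀ {k xs} → SquareBlocks k xs → SquareBlocks k (drop 1 xs)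
SquareBlocks-tail []                  = []
SquareBlocks-tail (block []      v c) = SquareBlocks-suc (SquareBlocks-tail c)
SquareBlocks-tail (block (_ ∷ a) v c) = block a (SquareBlock-tail v) c

SquareBlocks-drop : ∀ {k xs} n → SquareBlocks k xs → SquareBlocks k (drop n xs)
SquareBlocks-drop           zero    c = c
SquareBlocks-drop {xs = xs} (suc n) c =
  subst (SquareBlocks _) (drop-drop 1 n xs) (SquareBlocks-drop n (SquareBlocks-tail c))

SquareBlocks-++ : ∀ {k b a} → SquareBlocks k b → SquareBlock a → SquareBlocks (suc k) (b ++ a)
SquareBlocks-++ {a = a} [] v = subst (SquareBlocks _) (++-identityʳ a) (block a v [])
SquareBlocks-++ {a = a} (block a′ {b′} v′ c) v =
  subst (SquareBlocks _) (sym (++-assoc a′ b′ a)) (block a′ v′ (SquareBlocks-++ c v))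

SquareBlocks-reverse : ∀ {k xs} → SquareBlocks k xs → SquareBlocks k (reverse xs)
SquareBlocks-reverse []                 = []
SquareBlocks-reverse (block a {b} v c) =
  subst (SquareBlocks _) (sym (reverse-++ a b)) (SquareBlocks-++ (SquareBlocks-reverse c) (SquareBlock-reverse v))

SquareBlocks-reverse⇔ : ∀ {k xs} → SquareBlocks k xs ⇔ SquareBlocks k (reverse xs)
SquareBlocks-reverse⇔ {xs = xs} = mk⇔ SquareBlocks-reverse
  (λ c → subst (SquareBlocks _) (reverse-involutive xs) (SquareBlocks-reverse c))

peel : (List ℕ → ℕ) → List ℕ → List ℕ
peel side xs = drop (side xs) xs

drop-++-≥ : ∀ (a b : List ℕ) {n} → length a ≤ n → drop n (a ++ b) ≡ drop (n ∸ length a) b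
drop-++-≥ []      b _         = refl
drop-++-≥ (_ ∷ a) b (s≤s le) = drop-++-≥ a b le

Covers : (List ℕ → ℕ) → Set
Covers side = ∀ {a} b → SquareBlock a → length a ≤ side (a ++ b)

peel-greedy : ∀ side → Covers side → ∀ {k xs} → SquareBlocks (suc k) xs → SquareBlocks k (peel side xs)
peel-greedy side _ [] = subst (SquareBlocks _) (sym (drop-[] (side []))) []
peel-greedy side covers (block a {b} v c) =
  subst (SquareBlocks _) (sym (drop-++-≥ a b (covers b v))) (SquareBlocks-drop (side (a ++ b) ∸ length a) c)

peel-empties : ∀ side → Covers side → ∀ k {xs} → SquareBlocks k xs → iter (peel side) k xs ≡ []
peel-empties side covers zero    c = SquareBlocks-zero c
peel-empties side covers (suc k) {xs} c =
  trans (iter-suc (peel side) k xs) (peel-empties side covers k (peel-greedy side covers c))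

peel-builds : ∀ side {ℓ} {R : Rel ℕ ℓ} → (∀ {xs} → Linked R xs → SquareBlock (take (side xs) xs)) →
              ∀ k {xs} → Linked R xs → iter (peel side) k xs ≡ [] → SquareBlocks k xs
peel-builds side square zero    l e = subst (SquareBlocks 0) (sym e) []
peel-builds side square (suc k) {xs} l e =
  subst (SquareBlocks _) (take++drop≡id (side xs) xs)
    (block _ (square l) (peel-builds side square k (Linked-drop (side xs) l) (trans (sym (iter-suc (peel side) k xs)) e)))

peel⇔SquareBlocks : ∀ side {ℓ} {R : Rel ℕ ℓ} → Covers side →
                    (∀ {xs} → Linked R xs → SquareBlock (take (side xs) xs)) →
                    ∀ k {xs} → Linked R xs → (iter (peel side) k xs ≡ []) ⇔ SquareBlocks k xs
peel⇔SquareBlocks side covers square k l = mk⇔ (peel-builds side square k l) (peel-empties side covers k)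

-- Parts are 0-indexed here, and positions past the end carry the part 0.
part : List ℕ → ℕ → ℕ
part []       _       = 0
part (x ∷ _)  zero    = x
part (_ ∷ xs) (suc i) = part xs i

sqFrom-≥ : ∀ d x a b → All (d + length a ≤_) (x ∷ a) → d + length a ≤ sqFrom d (x ∷ a ++ b)
sqFrom-≥ d x [] b (p ∷ []) rewrite +-identityʳ d | dec-true (d ≤? x) p = m≤m⊔n d _
sqFrom-≥ d x (y ∷ a) b (_ ∷ ps) =
  ≤-trans (≤-reflexive (+-suc d (length a)))
    (≤-trans (sqFrom-≥ (suc d) y a b (subst (λ n → All (n ≤_) (y ∷ a)) (+-suc d (length a)) ps))
             (m≤n⊔m (if does (d ≤? x) then d else 0) _))

sq-covers : Covers sq
sq-covers b []        = z≤n
sq-covers b v@(_ ∷ _) = sqFrom-≥ 1 _ _ b v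

Attained : ℕ → List ℕ → ℕ → Set
Attained d xs e = e ≡ 0 ⊎ ∃ λ i → e ≡ d + i × e ≤ part xs i

sqFrom-attained : ∀ d xs → Attained d xs (sqFrom d xs)
sqFrom-attained d []       = inj₁ refl
sqFrom-attained d (x ∷ xs) with ⊔-sel (if does (d ≤? x) then d else 0) (sqFrom (suc d) xs)
... | inj₁ eq = subst (Attained d (x ∷ xs)) (sym eq) (here (d ≤? x))
  where
  here : (d≤?x : Dec (d ≤ x)) → Attained d (x ∷ xs) (if does d≤?x then d else 0)
  here (yes p) = inj₂ (0 , sym (+-identityʳ d) , p)
  here (no _)  = inj₁ refl
... | inj₂ eq = subst (Attained d (x ∷ xs)) (sym eq) (shift (sqFrom-attained (suc d) xs))
  where
  shift : ∀ {e} → Attained (suc d) xs e → Attained d (x ∷ xs) e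
  shift (inj₁ e≡0)           = inj₁ e≡0
  shift (inj₂ (i , e≡ , le)) = inj₂ (suc i , trans e≡ (sym (+-suc d i)) , le)

Sorted-take : ∀ {xs} → Sorted xs → ∀ i {v} → 1 ≤ v → v ≤ part xs i → All (v ≤_) (take (suc i) xs)
Sorted-take {[]}        _       i       _       _ = []
Sorted-take {_ ∷ _}     _       zero    _       p = p ∷ []
Sorted-take {_ ∷ []}    _       (suc i) (s≤s _) ()
Sorted-take {_ ∷ _ ∷ _} (r ∷ l) (suc i) 1≤v     p with Sorted-take l i 1≤v p
... | q ∷ qs = ≤-trans q r ∷ q ∷ qs

sq-square : ∀ {xs} → Sorted xs → SquareBlock (take (sq xs) xs)
sq-square {xs} l with sq xs | sqFrom-attained 1 xs
... | .0       | inj₁ refl            = []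
... | .(suc i) | inj₂ (i , refl , le) = SquareBlock-take (suc i) xs (Sorted-take l i (s≤s z≤n) le)

Durfee⇔SquareBlocks : ∀ k {λ′} → Sorted λ′ → (iter removeDurfee k λ′ ≡ []) ⇔ SquareBlocks k λ′
Durfee⇔SquareBlocks = peel⇔SquareBlocks sq sq-covers sq-square

topSide : List ℕ → ℕ
topSide []        = 0
topSide ρ@(z ∷ _) = z ⊓ length ρ

topSide-covers : Covers topSide
topSide-covers b []         = z≤n
topSide-covers {a} b (p ∷ _) =
  ⊓-glb p (≤-trans (m≤m+n (length a) (length b)) (≤-reflexive (sym (length-++ a))))

topSide-square : ∀ {ρ} → Linked _≤_ ρ → SquareBlock (take (topSide ρ) ρ)
topSide-square {[]}        _ = []
topSide-square {ρ@(z ∷ _)} l =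
  SquareBlock-take (topSide ρ) ρ (take⁺ _ (All.map (≤-trans (m⊓n≤m z _)) (Linked⇒All ≤-trans ≤-refl l)))

removeBottom-last : ∀ ν {x} → last ν ≡ just x → removeBottom ν ≡ reverse (drop (x ⊓ length ν) (reverse ν))
removeBottom-last ν eq with last ν
removeBottom-last ν refl | just x = refl

last-ʳ++ : ∀ (xs : List ℕ) {z acc} → last (xs ʳ++ z ∷ acc) ≡ last (z ∷ acc)
last-ʳ++ []       = refl
last-ʳ++ (_ ∷ xs) = last-ʳ++ xs

removeBottom-reverse : ∀ ρ → removeBottom (reverse ρ) ≡ reverse (peel topSide ρ)
removeBottom-reverse []         = refl
removeBottom-reverse ρ@(z ∷ ρ′) =
  trans (removeBottom-last (reverse ρ) (last-ʳ++ ρ′))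
        (cong reverse (cong₂ drop (cong (z ⊓_) (length-reverse ρ)) (reverse-involutive ρ)))

iter-removeBottom-reverse : ∀ k ρ → iter removeBottom k (reverse ρ) ≡ reverse (iter (peel topSide) k ρ)
iter-removeBottom-reverse zero    ρ = refl
iter-removeBottom-reverse (suc k) ρ =
  trans (cong removeBottom (iter-removeBottom-reverse k ρ)) (removeBottom-reverse (iter (peel topSide) k ρ))

reverse≡[]⇔ : ∀ {xs : List ℕ} → (reverse xs ≡ []) ⇔ (xs ≡ [])
reverse≡[]⇔ = mk⇔ reverse-injective (λ { refl → refl })

Bottom⇔SquareBlocks : ∀ k {λ′} → Sorted λ′ → (iter removeBottom k λ′ ≡ []) ⇔ SquareBlocks k λ′
Bottom⇔SquareBlocks k {λ′} l = begin
  iter removeBottom k λ′ ≡ []                          ≡⟨ cong (λ ν → iter removeBottom k ν ≡ []) (sym (reverse-involutive λ′)) ⟩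
  iter removeBottom k (reverse (reverse λ′)) ≡ []      ≡⟨ cong (_≡ []) (iter-removeBottom-reverse k (reverse λ′)) ⟩
  reverse (iter (peel topSide) k (reverse λ′)) ≡ []    ∼⟨ reverse≡[]⇔ ⟩
  iter (peel topSide) k (reverse λ′) ≡ []              ∼⟨ peel⇔SquareBlocks topSide topSide-covers topSide-square k (Linked-reverse l) ⟩
  SquareBlocks k (reverse λ′)                          ∼⟨ ⇔.sym SquareBlocks-reverse⇔ ⟩
  SquareBlocks k λ′                                    ∎
  where open EquationalReasoning {k = equivalence}

Bottom⇔Durfee : ∀ k {λ′} → Sorted λ′ → (iter removeBottom k λ′ ≡ []) ⇔ (iter removeDurfee k λ′ ≡ [])
Bottom⇔Durfee k l = ⇔.trans (Bottom⇔SquareBlocks k l) (⇔.sym (Durfee⇔SquareBlocks k l))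

theorem3p3 : (r : ℕ) → 2 ≤ r → (λ' : List ℕ) → (InB r λ' → InD r λ') × (InD r λ' → InB r λ')
theorem3p3 r _ λ′ =
  (λ (p@(_ , sorted) , e) → p , to   (Bottom⇔Durfee (r ∸ 1) sorted) e) ,
  (λ (p@(_ , sorted) , e) → p , from (Bottom⇔Durfee (r ∸ 1) sorted) e)
  where open Equivalence
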